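{- Let $N\ge 3$. The $N$-tuple $(2,2,\dots,2)\in(\mathbb{Z}/N\mathbb{Z})^N$ is an irreducible solution of $(E_N)$.
   Context: For $a_1,\dots,a_n\in\mathbb{Z}/N\mathbb{Z}$ set $M_n(a_1,\dots,a_n)=\begin{pmatrix}a_n&-1\\1&0\end{pmatrix}\cdots\begin{pmatrix}a_1&-1\\1&0\end{pmatrix}$. An $n$-tuple is a solution of $(E_N)$ if $M_n(a_1,\dots,a_n)=\pm\mathrm{Id}$ over $\mathbb{Z}/N\mathbb{Z}$. The sum of $(a_1,\dots,a_n)$ and $(b_1,\dots,b_m)$ is $(a_1+b_m,a_2,\dots,a_{n-1},a_n+b_1,b_2,\dots,b_{m-1})$. Two $n$-tuples are equivalent ($\sim$) if one is a cyclic permutation of the other or of its reversal. A solution $(c_1,\dots,c_n)$ with $n\ge3$ is reducible if there exist solutions $(a_1,\dots,a_m)$, $(b_1,\dots,b_l)$ with $m,l\ge3$ and $(c_1,\dots,c_n)\sim(a_1,\dots,a_m)\oplus(b_1,\dots,b_l)$; a solution of size $\ge3$ is irreducible if it is not reducible. -}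

module Defs where

open import Data.Nat using (ℕ; zero; suc; _≤_; _<_)
open import Data.Integer using (ℤ; +_; _+_; _-_; _*_; -_)
open import Data.Integer.Divisibility using (_∣_)
open import Data.List using (List; []; _∷_; length; reverse; take; drop; _++_; replicate)
open import Data.List.Relation.Binary.Pointwise using (Pointwise)
open import Data.Product using (_×_; Σ; ∃; ∃-syntax; _,_)
open import Data.Sum using (_⊎_)
open import Relation.Nullary using (¬_)

-- Z/NZ is modelled by ℤ together with congruence modulo N.
_≡[_]_ : ℤ → ℕ → ℤ → Set
a ≡[ N ] b = (+ N) ∣ (a - b)

record Mat : Set where
  constructor mat
  field
    p q r s : ℤ

_·_ : Mat → Mat → Mat
mat a b c d · mat e f g h = mat (a * e + b * g) (a * f + b * h) (c * e + d * g) (c * f + d * h)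

Id : Mat
Id = mat (+ 1) (+ 0) (+ 0) (+ 1)

-Id : Mat
-Id = mat (- + 1) (+ 0) (+ 0) (- + 1)

A : ℤ → Mat
A a = mat a (- + 1) (+ 1) (+ 0)

M : List ℤ → Mat
M [] = Id
M (a ∷ as) = M as · A a

_≈M[_]_ : Mat → ℕ → Mat → Set
mat a b c d ≈M[ N ] mat e f g h =
  (a ≡[ N ] e) × (b ≡[ N ] f) × (c ≡[ N ] g) × (d ≡[ N ] h)

Solution : ℕ → List ℤ → Set
Solution N as = (M as ≈M[ N ] Id) ⊎ (M as ≈M[ N ] -Id)

-- list helpers (only used on lists of length ≥ 3)
headD : List ℤ → ℤ
headD [] = + 0
headD (x ∷ _) = x

lastD : List ℤ → ℤ
lastD [] = + 0
lastD (x ∷ []) = x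
lastD (_ ∷ y ∷ ys) = lastD (y ∷ ys)

init : List ℤ → List ℤ
init [] = []
init (x ∷ []) = []
init (x ∷ y ∷ ys) = x ∷ init (y ∷ ys)

tail : List ℤ → List ℤ
tail [] = []
tail (_ ∷ xs) = xs

-- (a_1,…,a_n) ⊕ (b_1,…,b_m)
--   = (a_1 + b_m, a_2, …, a_{n-1}, a_n + b_1, b_2, …, b_{m-1})
_⊕_ : List ℤ → List ℤ → List ℤ
as ⊕ bs = (headD as + lastD bs) ∷ (init (tail as) ++ ((lastD as + headD bs) ∷ init (tail bs)))

rotate : ℕ → List ℤ → List ℤ
rotate k xs = drop k xs ++ take k xs

_≈[_]_ : List ℤ → ℕ → List ℤ → Set
xs ≈[ N ] ys = Pointwise (λ a b → a ≡[ N ] b) xs ys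

Equiv : ℕ → List ℤ → List ℤ → Set
Equiv N xs ys = ∃[ k ] (k < length ys ×
  ((xs ≈[ N ] rotate k ys) ⊎ (xs ≈[ N ] rotate k (reverse ys))))

Reducible : ℕ → List ℤ → Set
Reducible N cs = ∃[ as ] ∃[ bs ]
  (Solution N as × Solution N bs × 3 ≤ length as × 3 ≤ length bs ×
   Equiv N cs (as ⊕ bs))

IrreducibleSolution : ℕ → List ℤ → Set
IrreducibleSolution N cs = Solution N cs × 3 ≤ length cs × ¬ Reducible N cs

-- Writing M_n(a_1,…,a_n) = M(a_2,…,a_{n-1}) sandwiched between A(a_1) and A(a_n), the
-- bottom-right entry of M_n is −p, where p is the top-left entry of the inner product.
-- For the constant tuple (2,…,2) of length k one has M_k = ( k+1 −k ; k 1−k ), so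
-- (2,…,2) of length N is a solution of (E_N). If it were equivalent to a ⊕ b, then a would
-- be a solution of length m = k + 2 whose k inner entries are all 2; its bottom-right
-- entry −(k+1) must be ±1 modulo N, so N divides m or k. But 0 < k < m < N because b
-- contributes at least one further entry to a ⊕ b, which has length N.
module Submission where

open import Defs
open import Data.Nat using (ℕ; suc; _≤_; _<_; s≤s; >-nonZero)
import Data.Nat as ℕ
open import Data.Nat.Divisibility using (>⇒∤; ∣-refl) renaming (_∣_ to _∣ℕ_)
open import Data.Nat.Properties using (+-identityʳ; +-comm; +-monoʳ-≤; m≤n+m; ≤-<-trans)
open import Data.Integer using (ℤ; +_; _+_; _-_; _*_; -_; ∣_∣)
open import Data.Integer.Properties using (+-inverseʳ)
import Data.Integer.Divisibility.Signed as Signed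
open import Data.Integer.Tactic.RingSolver using (solve-∀)
open import Data.List using (List; []; _∷_; length; reverse; take; drop; replicate; _∷ʳ_)
open import Data.List.Properties using (length-replicate; length-++; take++drop≡id)
open import Data.List.Relation.Unary.All using (All; []; _∷_)
import Data.List.Relation.Unary.All as All
open import Data.List.Relation.Unary.All.Properties using (++⁻ˡ; replicate⁺)
open import Data.List.Relation.Binary.Pointwise using ([]; _∷_; All-resp-Pointwise; Pointwise-length)
open import Data.List.Relation.Binary.Permutation.Propositional using (_↭_; ↭-trans; ↭-reflexive)
open import Data.List.Relation.Binary.Permutation.Propositional.Properties
  using (All-resp-↭; ↭-length; ↭-reverse) renaming (++-comm to ↭-++-comm)
open import Data.Product using (_×_; ∃-syntax; _,_; proj₁)
open import Data.Sum using (_⊎_; inj₁; inj₂; [_,_])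
import Data.Sum as Sum
open import Relation.Binary.PropositionalEquality using (_≡_; _≢_; refl; sym; trans; cong; subst; module ≡-Reasoning)
open import Relation.Nullary using (¬_)

-- Congruence modulo N unfolds during unification, so its endpoints cannot be inferred
-- and are passed explicitly throughout.
module _ {N : ℕ} where

  private
    toSigned : ∀ a b → a ≡[ N ] b → + N Signed.∣ (a - b)
    toSigned a b = Signed.∣ᵤ⇒∣ {+ N} {a - b}

    fromSigned : ∀ a b → + N Signed.∣ (a - b) → a ≡[ N ] b
    fromSigned a b = Signed.∣⇒∣ᵤ {+ N} {a - b}

  mod-refl : ∀ a → a ≡[ N ] a
  mod-refl a = fromSigned a a (subst (+ N Signed.∣_) (sym (+-inverseʳ a)) (Signed.divides (+ 0) refl))

  mod-sym : ∀ a b → a ≡[ N ] b → b ≡[ N ] a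
  mod-sym a b h = fromSigned b a (subst (+ N Signed.∣_) (negate-diff a b) (Signed.∣m⇒∣-m (toSigned a b h)))
    where
    negate-diff : ∀ a b → - (a - b) ≡ b - a
    negate-diff = solve-∀

  mod-trans : ∀ a b c → a ≡[ N ] b → b ≡[ N ] c → a ≡[ N ] c
  mod-trans a b c h k = fromSigned a c (subst (+ N Signed.∣_) (telescope a b c)
    (Signed.∣m∣n⇒∣m+n (toSigned a b h) (toSigned b c k)))
    where
    telescope : ∀ a b c → (a - b) + (b - c) ≡ a - c
    telescope = solve-∀

  +-cong-mod : ∀ a b c d → a ≡[ N ] b → c ≡[ N ] d → (a + c) ≡[ N ] (b + d)
  +-cong-mod a b c d h k = fromSigned (a + c) (b + d) (subst (+ N Signed.∣_) (sum-diff a b c d)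
    (Signed.∣m∣n⇒∣m+n (toSigned a b h) (toSigned c d k)))
    where
    sum-diff : ∀ a b c d → (a - b) + (c - d) ≡ (a + c) - (b + d)
    sum-diff = solve-∀

  *-cong-mod : ∀ a b c d → a ≡[ N ] b → c ≡[ N ] d → (a * c) ≡[ N ] (b * d)
  *-cong-mod a b c d h k = fromSigned (a * c) (b * d) (subst (+ N Signed.∣_) (product-diff a b c d)
    (Signed.∣m∣n⇒∣m+n (Signed.∣m⇒∣m*n c (toSigned a b h)) (Signed.∣n⇒∣m*n b (toSigned c d k))))
    where
    product-diff : ∀ a b c d → (a - b) * c + b * (c - d) ≡ a * c - b * d
    product-diff = solve-∀

  -‿cong-mod : ∀ a b → a ≡[ N ] b → (- a) ≡[ N ] (- b)
  -‿cong-mod a b h = fromSigned (- a) (- b) (subst (+ N Signed.∣_) (negation-diff a b)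
    (Signed.∣m⇒∣-m (toSigned a b h)))
    where
    negation-diff : ∀ a b → - (a - b) ≡ - a - - b
    negation-diff = solve-∀

  modulus≡0 : (+ N) ≡[ N ] (+ 0)
  modulus≡0 = subst (N ∣ℕ_) (sym (+-identityʳ N)) ∣-refl

  ≡-mod⇒∣ : ∀ a b {m} → a ≡[ N ] b → a - b ≡ + m → N ∣ℕ m
  ≡-mod⇒∣ a b a≡b a-b≡m = subst (λ z → N ∣ℕ ∣ z ∣) a-b≡m a≡b

mat-cong : ∀ {p q r s p′ q′ r′ s′} → p ≡ p′ → q ≡ q′ → r ≡ r′ → s ≡ s′ → mat p q r s ≡ mat p′ q′ r′ s′
mat-cong refl refl refl refl = refl

·-identityˡ : ∀ P → Id · P ≡ P
·-identityˡ (mat a b c d) = mat-cong (first a c) (first b d) (second a c) (second b d)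
  where
  first : ∀ x y → + 1 * x + + 0 * y ≡ x
  first = solve-∀
  second : ∀ x y → + 0 * x + + 1 * y ≡ y
  second = solve-∀

·-identityʳ : ∀ P → P · Id ≡ P
·-identityʳ (mat a b c d) = mat-cong (first a b) (second a b) (first c d) (second c d)
  where
  first : ∀ x y → x * + 1 + y * + 0 ≡ x
  first = solve-∀
  second : ∀ x y → x * + 0 + y * + 1 ≡ y
  second = solve-∀

·-assoc : ∀ P Q R → (P · Q) · R ≡ P · (Q · R)
·-assoc (mat a b c d) (mat e f g h) (mat i j k l) =
  mat-cong (entry a b e f g h i k) (entry a b e f g h j l) (entry c d e f g h i k) (entry c d e f g h j l)
  where
  entry : ∀ x y e f g h u v →
          (x * e + y * g) * u + (x * f + y * h) * v ≡ x * (e * u + f * v) + y * (g * u + h * v)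
  entry = solve-∀

·-cong-mod : ∀ {N} P P′ Q Q′ → P ≈M[ N ] P′ → Q ≈M[ N ] Q′ → (P · Q) ≈M[ N ] (P′ · Q′)
·-cong-mod {N} (mat a b c d) (mat a′ b′ c′ d′) (mat e f g h) (mat e′ f′ g′ h′)
           (a≡ , b≡ , c≡ , d≡) (e≡ , f≡ , g≡ , h≡) =
  row-col a a′ e e′ b b′ g g′ a≡ e≡ b≡ g≡ , row-col a a′ f f′ b b′ h h′ a≡ f≡ b≡ h≡ ,
  row-col c c′ e e′ d d′ g g′ c≡ e≡ d≡ g≡ , row-col c c′ f f′ d d′ h h′ c≡ f≡ d≡ h≡
  where
  row-col : ∀ x x′ y y′ z z′ w w′ → x ≡[ N ] x′ → y ≡[ N ] y′ → z ≡[ N ] z′ → w ≡[ N ] w′ →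
            (x * y + z * w) ≡[ N ] (x′ * y′ + z′ * w′)
  row-col x x′ y y′ z z′ w w′ h₁ h₂ h₃ h₄ =
    +-cong-mod (x * y) (x′ * y′) (z * w) (z′ * w′) (*-cong-mod x x′ y y′ h₁ h₂) (*-cong-mod z z′ w w′ h₃ h₄)

A-cong-mod : ∀ {N} a b → a ≡[ N ] b → A a ≈M[ N ] A b
A-cong-mod a b h = h , mod-refl (- + 1) , mod-refl (+ 1) , mod-refl (+ 0)

M-cong-mod : ∀ {N xs ys} → xs ≈[ N ] ys → M xs ≈M[ N ] M ys
M-cong-mod [] = mod-refl (+ 1) , mod-refl (+ 0) , mod-refl (+ 0) , mod-refl (+ 1)
M-cong-mod {xs = x ∷ xs} {y ∷ ys} (h ∷ hs) = ·-cong-mod (M xs) (M ys) (A x) (A y) (M-cong-mod hs) (A-cong-mod x y h)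

M-∷ʳ : ∀ xs y → M (xs ∷ʳ y) ≡ A y · M xs
M-∷ʳ [] y = trans (·-identityˡ (A y)) (sym (·-identityʳ (A y)))
M-∷ʳ (x ∷ xs) y = begin
  M (xs ∷ʳ y) · A x   ≡⟨ cong (_· A x) (M-∷ʳ xs y) ⟩
  (A y · M xs) · A x  ≡⟨ ·-assoc (A y) (M xs) (A x) ⟩
  A y · (M xs · A x)  ∎
  where open ≡-Reasoning

M-s-∷-∷ʳ : ∀ x zs y → Mat.s (M (x ∷ zs ∷ʳ y)) ≡ - Mat.p (M zs)
M-s-∷-∷ʳ x zs y rewrite M-∷ʳ zs y with M zs
... | mat p q r s = bottom-right p q r s
  where
  bottom-right : ∀ p q r s → (+ 1 * p + + 0 * r) * - + 1 + (+ 1 * q + + 0 * s) * + 0 ≡ - p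
  bottom-right = solve-∀

M-replicate-2 : ∀ n → M (replicate n (+ 2)) ≡ mat (+ 1 + + n) (- + n) (+ n) (+ 1 - + n)
M-replicate-2 ℕ.zero = refl
M-replicate-2 (suc n) rewrite M-replicate-2 n =
  mat-cong (top-left (+ n)) (top-right (+ n)) (bottom-left (+ n)) (bottom-right (+ n))
  where
  top-left : ∀ x → (+ 1 + x) * + 2 + - x * + 1 ≡ + 1 + (+ 1 + x)
  top-left = solve-∀
  top-right : ∀ x → (+ 1 + x) * - + 1 + - x * + 0 ≡ - (+ 1 + x)
  top-right = solve-∀
  bottom-left : ∀ x → x * + 2 + (+ 1 - x) * + 1 ≡ + 1 + x
  bottom-left = solve-∀
  bottom-right : ∀ x → x * - + 1 + (+ 1 - x) * + 0 ≡ + 1 - (+ 1 + x)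
  bottom-right = solve-∀

replicate-2-solution : ∀ N → Solution N (replicate N (+ 2))
replicate-2-solution N = inj₁ (subst (_≈M[ N ] Id) (sym (M-replicate-2 N))
  ( +-cong-mod (+ 1) (+ 1) (+ N) (+ 0) (mod-refl (+ 1)) modulus≡0
  , -‿cong-mod (+ N) (+ 0) modulus≡0
  , modulus≡0
  , +-cong-mod (+ 1) (+ 1) (- + N) (+ 0) (mod-refl (+ 1)) (-‿cong-mod (+ N) (+ 0) modulus≡0)))

≡-mod-all⇒≈replicate : ∀ {N} c xs → All (λ x → x ≡[ N ] c) xs → xs ≈[ N ] replicate (length xs) c
≡-mod-all⇒≈replicate c [] [] = []
≡-mod-all⇒≈replicate c (x ∷ xs) (h ∷ hs) = h ∷ ≡-mod-all⇒≈replicate c xs hs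

M-p-≡-mod-2 : ∀ {N} zs → All (λ z → z ≡[ N ] (+ 2)) zs → Mat.p (M zs) ≡[ N ] (+ suc (length zs))
M-p-≡-mod-2 {N} zs all2 =
  subst (λ P → Mat.p (M zs) ≡[ N ] Mat.p P) (M-replicate-2 (length zs))
    (proj₁ (M-cong-mod (≡-mod-all⇒≈replicate (+ 2) zs all2)))

Solution⇒s≡±1 : ∀ {N} as → Solution N as → Mat.s (M as) ≡[ N ] (+ 1) ⊎ Mat.s (M as) ≡[ N ] (- + 1)
Solution⇒s≡±1 _ (inj₁ (_ , _ , _ , s≡1)) = inj₁ s≡1
Solution⇒s≡±1 _ (inj₂ (_ , _ , _ , s≡-1)) = inj₂ s≡-1

M-s-≡-mod-2 : ∀ {N} x zs y → All (λ z → z ≡[ N ] (+ 2)) zs →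
              Mat.s (M (x ∷ zs ∷ʳ y)) ≡[ N ] (- + suc (length zs))
M-s-≡-mod-2 {N} x zs y all2 = subst (_≡[ N ] (- + suc (length zs))) (sym (M-s-∷-∷ʳ x zs y))
  (-‿cong-mod (Mat.p (M zs)) (+ suc (length zs)) (M-p-≡-mod-2 zs all2))

solution-with-inner-2s⇒∣ : ∀ {N} x zs y → Solution N (x ∷ zs ∷ʳ y) → All (λ z → z ≡[ N ] (+ 2)) zs →
                            N ∣ℕ 2 ℕ.+ length zs ⊎ N ∣ℕ length zs
solution-with-inner-2s⇒∣ {N} x zs y sol all2 = Sum.map
  (λ s≡1 → ≡-mod⇒∣ (+ 1) -[k+1] (-[k+1]≡ (+ 1) s≡1) (one-minus (+ length zs)))
  (λ s≡-1 → ≡-mod⇒∣ (- + 1) -[k+1] (-[k+1]≡ (- + 1) s≡-1) (minus-one-minus (+ length zs)))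
  (Solution⇒s≡±1 (x ∷ zs ∷ʳ y) sol)
  where
  s -[k+1] : ℤ
  s = Mat.s (M (x ∷ zs ∷ʳ y))
  -[k+1] = - + suc (length zs)
  -[k+1]≡ : ∀ t → s ≡[ N ] t → t ≡[ N ] -[k+1]
  -[k+1]≡ t s≡t = mod-trans t s -[k+1] (mod-sym s t s≡t) (M-s-≡-mod-2 x zs y all2)
  one-minus : ∀ k → + 1 - - (+ 1 + k) ≡ + 2 + k
  one-minus = solve-∀
  minus-one-minus : ∀ k → - + 1 - - (+ 1 + k) ≡ k
  minus-one-minus = solve-∀

init-∷ʳ-lastD : ∀ y ys → y ∷ ys ≡ init (y ∷ ys) ∷ʳ lastD (y ∷ ys)
init-∷ʳ-lastD y [] = refl
init-∷ʳ-lastD y (z ∷ zs) = cong (y ∷_) (init-∷ʳ-lastD z zs)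

length-init : ∀ y ys → length (init (y ∷ ys)) ≡ length ys
length-init y [] = refl
length-init y (z ∷ zs) = cong suc (length-init z zs)

rotate-↭ : ∀ k (xs : List ℤ) → rotate k xs ↭ xs
rotate-↭ k xs = ↭-trans (↭-++-comm (drop k xs) (take k xs)) (↭-reflexive (take++drop≡id k xs))

Equiv⇒≈-↭ : ∀ {N cs ys} → Equiv N cs ys → ∃[ zs ] (cs ≈[ N ] zs × zs ↭ ys)
Equiv⇒≈-↭ {ys = ys} (k , _ , inj₁ cs≈) = rotate k ys , cs≈ , rotate-↭ k ys
Equiv⇒≈-↭ {ys = ys} (k , _ , inj₂ cs≈) =
  rotate k (reverse ys) , cs≈ , ↭-trans (rotate-↭ k (reverse ys)) (↭-reverse ys)

Equiv-replicate : ∀ {N} n c ys → Equiv N (replicate n c) ys →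
                  All (λ y → y ≡[ N ] c) ys × length ys ≡ n
Equiv-replicate {N} n c ys equiv with Equiv⇒≈-↭ equiv
... | zs , rep≈zs , zs↭ys =
  All-resp-↭ zs↭ys (All-resp-Pointwise (λ {x} {y} → ≡c-resp x y) rep≈zs (replicate⁺ n (mod-refl c))) ,
  trans (sym (↭-length zs↭ys)) (trans (sym (Pointwise-length rep≈zs)) (length-replicate n))
  where
  ≡c-resp : ∀ x y → x ≡[ N ] y → x ≡[ N ] c → y ≡[ N ] c
  ≡c-resp x y x≡y x≡c = mod-trans y x c (mod-sym x y x≡y) x≡c

⊕-not-all-2 : ∀ {N} as bs → Solution N as → 3 ≤ length as → 3 ≤ length bs →
              All (λ c → c ≡[ N ] (+ 2)) (as ⊕ bs) → length (as ⊕ bs) ≢ N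
⊕-not-all-2 [] _ _ () _ _ _
⊕-not-all-2 (_ ∷ []) _ _ (s≤s ()) _ _ _
⊕-not-all-2 (_ ∷ _ ∷ _) [] _ _ () _ _
⊕-not-all-2 (_ ∷ _ ∷ _) (_ ∷ []) _ _ (s≤s ()) _ _
⊕-not-all-2 {N} (x ∷ a ∷ as) (b ∷ b′ ∷ bs) sol (s≤s (s≤s 0<as)) (s≤s (s≤s 0<bs)) all2 len =
  [ >⇒∤ 2+k<N , >⇒∤ ⦃ >-nonZero 0<k ⦄ (≤-<-trans (m≤n+m k 2) 2+k<N) ]
    (solution-with-inner-2s⇒∣ x zs (lastD (a ∷ as)) sol′ (++⁻ˡ zs (All.tail all2)))
  where
  zs : List ℤ
  zs = init (a ∷ as)
  k j : ℕ
  k = length zs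
  j = length (init (b′ ∷ bs))
  sol′ : Solution N (x ∷ zs ∷ʳ lastD (a ∷ as))
  sol′ = subst (λ cs → Solution N (x ∷ cs)) (init-∷ʳ-lastD a as) sol
  0<k : 0 < k
  0<k = subst (0 <_) (sym (length-init a as)) 0<as
  0<j : 0 < j
  0<j = subst (0 <_) (sym (length-init b′ bs)) 0<bs
  N≡ : suc (k ℕ.+ suc j) ≡ N
  N≡ = trans (cong suc (sym (length-++ zs))) len
  2+k<N : 2 ℕ.+ k < N
  2+k<N = subst (2 ℕ.+ k <_) N≡ (s≤s (subst (_≤ k ℕ.+ suc j) (+-comm k 2) (+-monoʳ-≤ k (s≤s 0<j))))

theorem2p6 : (N : ℕ) → 3 ≤ N → IrreducibleSolution N (replicate N (+ 2))
theorem2p6 N 3≤N = replicate-2-solution N , subst (3 ≤_) (sym (length-replicate N)) 3≤N , irreducible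
  where
  irreducible : ¬ Reducible N (replicate N (+ 2))
  irreducible (as , bs , sol-as , _ , 3≤as , 3≤bs , equiv) =
    let all2 , len = Equiv-replicate N (+ 2) (as ⊕ bs) equiv
    in ⊕-not-all-2 as bs sol-as 3≤as 3≤bs all2 len
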